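{- Let $(y_n)_{n\ge1}$ be the Fibonacci sequence $y_1=y_2=1$, $y_{n+2}=y_{n+1}+y_n$, and let $A(n,k)$ be its output array. Then for $0\le k\le 4$ and all integers $n\ge k$ (with $n\ge1$) we have $A(n,k)=p_k(n)$, where $p_0(x)=1$, $p_1(x)=x$, $p_2(x)=\frac{(x-2)(x+3)}{2}$, $p_3(x)=\frac{(x-3)(x^2+6x+2)}{6}$, $p_4(x)=\frac{(x-4)(x+1)(x^2+9x+6)}{24}$.
   Context: For a nondecreasing sequence $(y_n)_{n\ge1}$ of positive integers and a positive integer $n$, an $n$-tuple $(x_1,\dots,x_n)$ of nonnegative integers is valid if $x_1\le y_n$ and $x_{j+1}\le\min(x_j,y_{n-j})$ for $1\le j\le n-1$. The output array $A(n,k)$ ($n\ge1$, $k\ge0$) counts valid $n$-tuples with $x_1=k$. -}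

module Defs where

open import Data.Nat using (ℕ; zero; suc; _+_; _*_; _∸_; _/_; _≤_)
open import Data.Vec using (Vec; []; _∷_)
open import Data.Product using (Σ; _×_)
open import Data.Unit using (⊤)
open import Relation.Binary.PropositionalEquality using (_≡_)

-- The Fibonacci sequence y₁ = y₂ = 1, y_{n+2} = y_{n+1} + y_n.
-- (The value at index 0 is never used; it is set to 0.)
fib : ℕ → ℕ
fib zero = 0
fib (suc zero) = 1
fib (suc (suc zero)) = 1
fib (suc (suc (suc n))) = fib (suc (suc n)) + fib (suc n)

-- Conditions on the entries after the first one, written out:
-- for a tail v = (x_{j+1}, …, x_n) following x_j = prev, we need
-- x_{j+1} ≤ min(x_j, y_{n-j}); note n - j = 1 + length of what follows x_{j+1}.
ValidTail : (ℕ → ℕ) → {r : ℕ} → ℕ → Vec ℕ r → Set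
ValidTail y prev [] = ⊤
ValidTail y prev (_∷_ {r} x v) = (x ≤ prev) × (x ≤ y (suc r)) × ValidTail y x v

Valid : (ℕ → ℕ) → (n : ℕ) → Vec ℕ n → Set
Valid y .zero [] = ⊤
Valid y (suc n) (x ∷ v) = (x ≤ y (suc n)) × ValidTail y x v

-- First entry of a tuple equals k (n ≥ 1 is assumed where used).
FirstIs : ℕ → {n : ℕ} → Vec ℕ n → Set
FirstIs k [] = ⊤
FirstIs k (x ∷ v) = x ≡ k

ATuples : (ℕ → ℕ) → ℕ → ℕ → Set
ATuples y n k = Σ (Vec ℕ n) (λ v → Valid y n v × FirstIs k v)

-- The polynomials p_k (natural-number arithmetic; the divisions are exact and
-- the truncated subtractions are genuine when n ≥ k, which is assumed).
p : ℕ → ℕ → ℕ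
p zero x = 1
p (suc zero) x = x
p (suc (suc zero)) x = ((x ∸ 2) * (x + 3)) / 2
p (suc (suc (suc zero))) x = ((x ∸ 3) * (x * x + 6 * x + 2)) / 6
p (suc (suc (suc (suc zero)))) x = ((x ∸ 4) * (x + 1) * (x * x + 9 * x + 6)) / 24
p (suc (suc (suc (suc (suc _))))) x = 0

-- A valid tuple with x₁ = k is k followed by a tail in which every entry is
-- bounded by its predecessor and by a cap from y; counting tails by their first
-- entry gives c(prev, r + 1) = Σ_{x ≤ min(prev, y_{r+1})} c(x, r). For y = fib
-- and r ≥ 4 the cap is at least 5, so for k ≤ 4 the counts are iterated partial
-- sums, c(k, r + 1) = Σ_{j ≤ k} c(j, r). The polynomials obey the same Pascal-type
-- rule p_k(n + 1) = Σ_{j ≤ k} p_j(n), which turns n = 5 (checked by computation)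
-- into an induction; the cases n ≤ 4 are a finite computation.
module Submission where

open import Defs
open import Data.Nat using (ℕ; zero; suc; _+_; _*_; _/_; _≤_; _≤?_; _⊓_; z≤n; s≤s; NonZero)
open import Data.Nat.Properties using (≤-irrelevant; ≤-trans; m≤m+n; ⊓-glb; m≤n⊓o⇒m≤n; m≤n⊓o⇒m≤o; m≤n⇒m⊓n≡m)
open import Data.Nat.DivMod using (m*n/n≡m)
open import Data.Nat.Tactic.RingSolver using (solve-∀)
open import Data.Fin using (Fin)
open import Data.Fin.Properties using (+↔⊎)
open import Data.Vec using (Vec; []; _∷_)
open import Data.Product using (Σ; Σ-syntax; _×_; _,_)
open import Data.Sum using (_⊎_; inj₁; inj₂)
open import Data.Sum.Function.Propositional using (_⊎-↔_)
open import Data.Unit using (tt)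
open import Relation.Nullary using (¬_; yes; no; contradiction)
open import Relation.Nullary.Decidable using (True; toWitness)
open import Function.Bundles using (_↔_; mk↔ₛ′)
open import Function.Properties.Inverse using (↔-trans; ↔-sym)
open import Relation.Binary.PropositionalEquality using (_≡_; refl; cong; cong₂; sym; trans; subst)
open Relation.Binary.PropositionalEquality.≡-Reasoning

sum≤ : ℕ → (ℕ → ℕ) → ℕ
sum≤ zero    f = f 0
sum≤ (suc b) f = f 0 + sum≤ b (λ x → f (suc x))

Σ≤ : ℕ → (ℕ → Set) → Set
Σ≤ b F = Σ[ x ∈ ℕ ] x ≤ b × F x

Σ≤-zero↔ : (F : ℕ → Set) → Σ≤ 0 F ↔ F 0
Σ≤-zero↔ F = mk↔ₛ′ (λ { (zero , z≤n , u) → u }) (λ u → 0 , z≤n , u)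
  (λ _ → refl) (λ { (zero , z≤n , u) → refl })

Σ≤-suc↔ : (b : ℕ) (F : ℕ → Set) → Σ≤ (suc b) F ↔ (F 0 ⊎ Σ≤ b (λ x → F (suc x)))
Σ≤-suc↔ b F = mk↔ₛ′ to from to∘from from∘to
  where
  to : Σ≤ (suc b) F → F 0 ⊎ Σ≤ b (λ x → F (suc x))
  to (zero  , z≤n    , u) = inj₁ u
  to (suc x , s≤s x≤b , u) = inj₂ (x , x≤b , u)
  from : F 0 ⊎ Σ≤ b (λ x → F (suc x)) → Σ≤ (suc b) F
  from (inj₁ u)             = 0 , z≤n , u
  from (inj₂ (x , x≤b , u)) = suc x , s≤s x≤b , u
  to∘from : ∀ s → to (from s) ≡ s
  to∘from (inj₁ _) = refl
  to∘from (inj₂ _) = refl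
  from∘to : ∀ s → from (to s) ≡ s
  from∘to (zero  , z≤n   , _) = refl
  from∘to (suc _ , s≤s _ , _) = refl

Fin-sum≤↔Σ≤ : (b : ℕ) {f : ℕ → ℕ} {F : ℕ → Set} →
              (∀ x → Fin (f x) ↔ F x) → Fin (sum≤ b f) ↔ Σ≤ b F
Fin-sum≤↔Σ≤ zero    {F = F} f↔F = ↔-trans (f↔F 0) (↔-sym (Σ≤-zero↔ F))
Fin-sum≤↔Σ≤ (suc b) {F = F} f↔F =
  ↔-trans +↔⊎ (↔-trans (f↔F 0 ⊎-↔ Fin-sum≤↔Σ≤ b (λ x → f↔F (suc x))) (↔-sym (Σ≤-suc↔ b F)))

module Counting (y : ℕ → ℕ) where

  Tails : ℕ → ℕ → Set
  Tails prev r = Σ (Vec ℕ r) (ValidTail y prev)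

  tailCount : ℕ → ℕ → ℕ
  tailCount prev zero    = 1
  tailCount prev (suc r) = sum≤ (prev ⊓ y (suc r)) (λ x → tailCount x r)

  tailCount-suc : ∀ {prev} r → prev ≤ y (suc r) →
                  tailCount prev (suc r) ≡ sum≤ prev (λ x → tailCount x r)
  tailCount-suc r prev≤y = cong (λ b → sum≤ b (λ x → tailCount x r)) (m≤n⇒m⊓n≡m prev≤y)

  Tails-zero↔ : (prev : ℕ) → Fin 1 ↔ Tails prev 0
  Tails-zero↔ prev = mk↔ₛ′ (λ _ → [] , tt) (λ _ → Fin.zero)
    (λ { ([] , tt) → refl }) (λ { Fin.zero → refl ; (Fin.suc ()) })

  Tails-suc↔ : (prev r : ℕ) → Tails prev (suc r) ↔ Σ≤ (prev ⊓ y (suc r)) (λ x → Tails x r)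
  Tails-suc↔ prev r = mk↔ₛ′ to from to∘from from∘to
    where
    to : Tails prev (suc r) → Σ≤ (prev ⊓ y (suc r)) (λ x → Tails x r)
    to (x ∷ v , x≤prev , x≤y , t) = x , ⊓-glb x≤prev x≤y , v , t
    from : Σ≤ (prev ⊓ y (suc r)) (λ x → Tails x r) → Tails prev (suc r)
    from (x , x≤⊓ , v , t) =
      x ∷ v , m≤n⊓o⇒m≤n prev (y (suc r)) x≤⊓ , m≤n⊓o⇒m≤o prev (y (suc r)) x≤⊓ , t
    to∘from : ∀ s → to (from s) ≡ s
    to∘from (x , _ , v , t) = cong (λ x≤⊓ → x , x≤⊓ , v , t) (≤-irrelevant _ _)
    from∘to : ∀ s → from (to s) ≡ s
    from∘to (x ∷ v , _ , _ , t) =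
      cong₂ (λ x≤prev x≤y → x ∷ v , x≤prev , x≤y , t) (≤-irrelevant _ _) (≤-irrelevant _ _)

  Fin-tailCount↔Tails : (r prev : ℕ) → Fin (tailCount prev r) ↔ Tails prev r
  Fin-tailCount↔Tails zero    prev = Tails-zero↔ prev
  Fin-tailCount↔Tails (suc r) prev =
    ↔-trans (Fin-sum≤↔Σ≤ (prev ⊓ y (suc r)) (Fin-tailCount↔Tails r)) (↔-sym (Tails-suc↔ prev r))

  tupleCount : ℕ → ℕ → ℕ
  tupleCount zero    k = 1
  tupleCount (suc r) k with k ≤? y (suc r)
  ... | yes _ = tailCount k r
  ... | no  _ = 0

  tupleCount-suc : ∀ {k} r → k ≤ y (suc r) → tupleCount (suc r) k ≡ tailCount k r
  tupleCount-suc {k} r k≤y with k ≤? y (suc r)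
  ... | yes _   = refl
  ... | no  k≰y = contradiction k≤y k≰y

  ATuples-zero↔ : (k : ℕ) → Fin 1 ↔ ATuples y 0 k
  ATuples-zero↔ k = mk↔ₛ′ (λ _ → [] , tt , tt) (λ _ → Fin.zero)
    (λ { ([] , tt , tt) → refl }) (λ { Fin.zero → refl ; (Fin.suc ()) })

  Tails↔ATuples : ∀ {k} r → k ≤ y (suc r) → Tails k r ↔ ATuples y (suc r) k
  Tails↔ATuples r k≤y = mk↔ₛ′ (λ (v , t) → _ ∷ v , (k≤y , t) , refl)
    (λ { (_ ∷ v , (_ , t) , refl) → v , t })
    (λ { (x ∷ v , (x≤y , t) , refl) → cong (λ x≤y → x ∷ v , (x≤y , t) , refl) (≤-irrelevant _ _) })
    (λ { (v , t) → refl })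

  ATuples-empty↔ : ∀ {k} r → ¬ k ≤ y (suc r) → Fin 0 ↔ ATuples y (suc r) k
  ATuples-empty↔ r k≰y = mk↔ₛ′ (λ ()) (λ { (_ ∷ _ , (k≤y , _) , refl) → contradiction k≤y k≰y })
    (λ { (_ ∷ _ , (k≤y , _) , refl) → contradiction k≤y k≰y }) (λ ())

  Fin-tupleCount↔ATuples : (n k : ℕ) → Fin (tupleCount n k) ↔ ATuples y n k
  Fin-tupleCount↔ATuples zero    k = ATuples-zero↔ k
  Fin-tupleCount↔ATuples (suc r) k with k ≤? y (suc r)
  ... | yes k≤y = ↔-trans (Fin-tailCount↔Tails r k) (Tails↔ATuples r k≤y)
  ... | no  k≰y = ATuples-empty↔ r k≰y

open Counting fib

5≤fib : ∀ m → 5 ≤ fib (5 + m)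
5≤fib zero    = s≤s (s≤s (s≤s (s≤s (s≤s z≤n))))
5≤fib (suc m) = ≤-trans (5≤fib m) (m≤m+n (fib (5 + m)) (fib (4 + m)))

≤4⇒≤fib : ∀ {k} m → k ≤ 4 → k ≤ fib (5 + m)
≤4⇒≤fib m k≤4 = ≤-trans k≤4 (≤-trans (s≤s (s≤s (s≤s (s≤s z≤n)))) (5≤fib m))

≤4-elim : (P : ℕ → Set) → P 0 → P 1 → P 2 → P 3 → P 4 → ∀ {k} → k ≤ 4 → P k
≤4-elim P p₀ p₁ p₂ p₃ p₄ z≤n                                 = p₀
≤4-elim P p₀ p₁ p₂ p₃ p₄ (s≤s z≤n)                           = p₁
≤4-elim P p₀ p₁ p₂ p₃ p₄ (s≤s (s≤s z≤n))                     = p₂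
≤4-elim P p₀ p₁ p₂ p₃ p₄ (s≤s (s≤s (s≤s z≤n)))               = p₃
≤4-elim P p₀ p₁ p₂ p₃ p₄ (s≤s (s≤s (s≤s (s≤s z≤n))))         = p₄

-- k ! · p k (5 + m), in the syntactic shape that p k (5 + m) reduces to.
scaledP₂ scaledP₃ scaledP₄ : ℕ → ℕ
scaledP₂ m = (3 + m) * (5 + m + 3)
scaledP₃ m = (2 + m) * ((5 + m) * (5 + m) + 6 * (5 + m) + 2)
scaledP₄ m = (1 + m) * (5 + m + 1) * ((5 + m) * (5 + m) + 9 * (5 + m) + 6)

scaledP₂-suc : ∀ m {a b} c → a ≡ 1 → b ≡ 5 + m → c * 2 ≡ scaledP₂ m →
               (a + (b + c)) * 2 ≡ scaledP₂ (suc m)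
scaledP₂-suc m c refl refl h₂ = begin
  (1 + (5 + m + c)) * 2           ≡⟨ expand m c ⟩
  2 + (5 + m) * 2 + c * 2         ≡⟨ cong (2 + (5 + m) * 2 +_) h₂ ⟩
  2 + (5 + m) * 2 + scaledP₂ m    ≡⟨ pascal m ⟩
  scaledP₂ (suc m)                ∎
  where
  expand : ∀ m c → (1 + (5 + m + c)) * 2 ≡ 2 + (5 + m) * 2 + c * 2
  expand = solve-∀
  pascal : ∀ m → 2 + (5 + m) * 2 + (3 + m) * (5 + m + 3) ≡ (3 + suc m) * (5 + suc m + 3)
  pascal = solve-∀

scaledP₃-suc : ∀ m {a b} c d → a ≡ 1 → b ≡ 5 + m → c * 2 ≡ scaledP₂ m → d * 6 ≡ scaledP₃ m →
               (a + (b + (c + d))) * 6 ≡ scaledP₃ (suc m)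
scaledP₃-suc m c d refl refl h₂ h₃ = begin
  (1 + (5 + m + (c + d))) * 6                            ≡⟨ expand m c d ⟩
  6 + (5 + m) * 6 + (c * 2) * 3 + d * 6                  ≡⟨ cong₂ (λ c₂ d₆ → 6 + (5 + m) * 6 + c₂ * 3 + d₆) h₂ h₃ ⟩
  6 + (5 + m) * 6 + scaledP₂ m * 3 + scaledP₃ m          ≡⟨ pascal m ⟩
  scaledP₃ (suc m)                                       ∎
  where
  expand : ∀ m c d → (1 + (5 + m + (c + d))) * 6 ≡ 6 + (5 + m) * 6 + (c * 2) * 3 + d * 6
  expand = solve-∀
  pascal : ∀ m → 6 + (5 + m) * 6 + ((3 + m) * (5 + m + 3)) * 3
                   + (2 + m) * ((5 + m) * (5 + m) + 6 * (5 + m) + 2)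
               ≡ (2 + suc m) * ((5 + suc m) * (5 + suc m) + 6 * (5 + suc m) + 2)
  pascal = solve-∀

scaledP₄-suc : ∀ m {a b} c d e → a ≡ 1 → b ≡ 5 + m → c * 2 ≡ scaledP₂ m → d * 6 ≡ scaledP₃ m →
               e * 24 ≡ scaledP₄ m → (a + (b + (c + (d + e)))) * 24 ≡ scaledP₄ (suc m)
scaledP₄-suc m c d e refl refl h₂ h₃ h₄ = begin
  (1 + (5 + m + (c + (d + e)))) * 24
    ≡⟨ expand m c d e ⟩
  24 + (5 + m) * 24 + (c * 2) * 12 + (d * 6) * 4 + e * 24
    ≡⟨ cong₂ (λ c₂ d₆ → 24 + (5 + m) * 24 + c₂ * 12 + d₆ * 4 + e * 24) h₂ h₃ ⟩
  24 + (5 + m) * 24 + scaledP₂ m * 12 + scaledP₃ m * 4 + e * 24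
    ≡⟨ cong (24 + (5 + m) * 24 + scaledP₂ m * 12 + scaledP₃ m * 4 +_) h₄ ⟩
  24 + (5 + m) * 24 + scaledP₂ m * 12 + scaledP₃ m * 4 + scaledP₄ m
    ≡⟨ pascal m ⟩
  scaledP₄ (suc m)
    ∎
  where
  expand : ∀ m c d e → (1 + (5 + m + (c + (d + e)))) * 24
                     ≡ 24 + (5 + m) * 24 + (c * 2) * 12 + (d * 6) * 4 + e * 24
  expand = solve-∀
  pascal : ∀ m → 24 + (5 + m) * 24 + ((3 + m) * (5 + m + 3)) * 12
                   + ((2 + m) * ((5 + m) * (5 + m) + 6 * (5 + m) + 2)) * 4
                   + (1 + m) * (5 + m + 1) * ((5 + m) * (5 + m) + 9 * (5 + m) + 6)
               ≡ (1 + suc m) * (5 + suc m + 1) * ((5 + suc m) * (5 + suc m) + 9 * (5 + suc m) + 6)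
  pascal = solve-∀

record ScaledTailCounts (m : ℕ) : Set where
  field
    count₀ : tailCount 0 (4 + m) ≡ 1
    count₁ : tailCount 1 (4 + m) ≡ 5 + m
    count₂ : tailCount 2 (4 + m) * 2 ≡ scaledP₂ m
    count₃ : tailCount 3 (4 + m) * 6 ≡ scaledP₃ m
    count₄ : tailCount 4 (4 + m) * 24 ≡ scaledP₄ m

scaledTailCounts : ∀ m → ScaledTailCounts m
scaledTailCounts zero    =
  record { count₀ = refl ; count₁ = refl ; count₂ = refl ; count₃ = refl ; count₄ = refl }
scaledTailCounts (suc m) = record
  { count₀ = count₀
  ; count₁ = trans (partialSum 1) (cong₂ _+_ count₀ count₁)
  ; count₂ = trans (cong (_* 2) (partialSum 2)) (scaledP₂-suc m (t 2) count₀ count₁ count₂)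
  ; count₃ = trans (cong (_* 6) (partialSum 3)) (scaledP₃-suc m (t 2) (t 3) count₀ count₁ count₂ count₃)
  ; count₄ = trans (cong (_* 24) (partialSum 4))
                    (scaledP₄-suc m (t 2) (t 3) (t 4) count₀ count₁ count₂ count₃ count₄)
  }
  where
  open ScaledTailCounts (scaledTailCounts m)
  t : ℕ → ℕ
  t k = tailCount k (4 + m)
  partialSum : ∀ k {k≤4 : True (k ≤? 4)} → tailCount k (5 + m) ≡ sum≤ k t
  partialSum k {k≤4} = tailCount-suc (4 + m) (≤4⇒≤fib m (toWitness k≤4))

*≡⇒≡/ : ∀ {c N} d .{{_ : NonZero d}} → c * d ≡ N → c ≡ N / d
*≡⇒≡/ {c} d c*d≡N = trans (sym (m*n/n≡m c d)) (cong (_/ d) c*d≡N)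

tailCount≡p : ∀ m {k} → k ≤ 4 → tailCount k (4 + m) ≡ p k (5 + m)
tailCount≡p m = ≤4-elim (λ k → tailCount k (4 + m) ≡ p k (5 + m))
  count₀ count₁ (*≡⇒≡/ 2 count₂) (*≡⇒≡/ 6 count₃) (*≡⇒≡/ 24 count₄)
  where open ScaledTailCounts (scaledTailCounts m)

tupleCount≡p : ∀ n {k} → k ≤ 4 → 1 ≤ n → tupleCount n k ≡ p k n
tupleCount≡p 1 k≤4 _ = ≤4-elim (λ k → tupleCount 1 k ≡ p k 1) refl refl refl refl refl k≤4
tupleCount≡p 2 k≤4 _ = ≤4-elim (λ k → tupleCount 2 k ≡ p k 2) refl refl refl refl refl k≤4
tupleCount≡p 3 k≤4 _ = ≤4-elim (λ k → tupleCount 3 k ≡ p k 3) refl refl refl refl refl k≤4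
tupleCount≡p 4 k≤4 _ = ≤4-elim (λ k → tupleCount 4 k ≡ p k 4) refl refl refl refl refl k≤4
tupleCount≡p (suc (suc (suc (suc (suc m))))) k≤4 _ =
  trans (tupleCount-suc (4 + m) (≤4⇒≤fib m k≤4)) (tailCount≡p m k≤4)

proposition3p5 : (k n : ℕ) → k ≤ 4 → k ≤ n → 1 ≤ n →
    Fin (p k n) ↔ ATuples fib n k
proposition3p5 k n k≤4 _ 1≤n =
  subst (λ c → Fin c ↔ ATuples fib n k) (tupleCount≡p n k≤4 1≤n) (Fin-tupleCount↔ATuples n k)
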